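{- For the torus of size $n\ge 3$, the normalizing factor satisfies $Z<\left(4\ln(n/2)\right)^{ -1}$.
   Context: Let $n\ge 3$, $[\![n]\!]=\{0,1,\dots,n-1\}$, and let $T$ be the two-dimensional undirected torus with vertex set $V=[\![n]\!]^2$, where $(i,j)$ is adjacent to $(i,(j+1)\bmod n)$ and $((i+1)\bmod n,j)$. For $u=(x_u,y_u),v=(x_v,y_v)\in V$, $d_{uv}=\min(|x_u-x_v|,n-|x_u-x_v|)+\min(|y_u-y_v|,n-|y_u-y_v|)$. The normalizing factor is $Z=\left(\sum_{v\in V\setminus\{u\}} d_{uv}^{ -2}\right)^{ -1}$ for any $u\in V$ (its value does not depend on $u$). $\ln$ denotes the natural logarithm. -}

module Defs where

open import Data.Nat as ℕ using (ℕ; zero; suc; _⊓_; _∸_; ∣_-_∣)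
open import Data.Fin using (Fin; toℕ)
open import Data.List using (List; []; _∷_; map; foldr; concatMap; allFin)
open import Data.Product using (_×_; _,_)
open import Data.Integer using (+_)
open import Data.Rational as ℚ using (ℚ; 0ℚ; 1ℚ; _+_; _*_; _/_)
open import Data.Nat.Base using (_!)
open import Data.Nat.Properties using (_!≢0)
open import Data.Product using (∃)

Vertex : ℕ → Set
Vertex n = Fin n × Fin n

cycDist : (n : ℕ) → Fin n → Fin n → ℕ
cycDist n a b = ∣ toℕ a - toℕ b ∣ ⊓ (n ∸ ∣ toℕ a - toℕ b ∣)

dist : (n : ℕ) → Vertex n → Vertex n → ℕ
dist n (xu , yu) (xv , yv) = cycDist n xu xv ℕ.+ cycDist n yu yv

-- d^{-2}, with value 0 when d = 0 (only occurs for v = u, i.e. the excluded term).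
invSq : ℕ → ℚ
invSq zero    = 0ℚ
invSq (suc k) = (+ 1) / (suc k ℕ.* suc k)

allVertices : (n : ℕ) → List (Vertex n)
allVertices n = concatMap (λ i → map (λ j → (i , j)) (allFin n)) (allFin n)

sumℚ : List ℚ → ℚ
sumℚ = foldr _+_ 0ℚ

-- Zinv n u = Σ_{v ∈ V \ {u}} d_uv^{-2}  ( = Z^{-1} ).  The term v = u has
-- d_uu = 0 and contributes invSq 0 = 0, so summing over all of V is the same
-- as summing over V \ {u}; and v ≠ u ⇒ d_uv ≥ 1 for the torus metric.
Zinv : (n : ℕ) → Vertex n → ℚ
Zinv n u = sumℚ (map (λ v → invSq (dist n u v)) (allVertices n))

powℚ : ℚ → ℕ → ℚ
powℚ r zero    = 1ℚ
powℚ r (suc j) = r * powℚ r j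

invFact : ℕ → ℚ
invFact j = (+ 1) / (j !)
  where instance _ = j !≢0

expPartial : ℚ → ℕ → ℚ
expPartial r zero    = 0ℚ
expPartial r (suc k) = expPartial r k + powℚ r k * invFact k

-- For rationals q > 0 and r:   ln q < r   ⇔   q < e^r
--   ⇔  ∃ k. q < Σ_{j<k} r^j/j!   (the partial sums increase to e^r when r ≥ 0;
-- in the statement r is always > 0).
LnLess : ℚ → ℚ → Set
LnLess q r = ∃ λ k → q ℚ.< expPartial r k

-- Z⁻¹ is a double sum over the two cyclic coordinates of v. If 2M + 1 ≤ n, a cyclic sum of h ≥ 0 over the
-- distances to a fixed point dominates h 0 + 2 (h 1 + ⋯ + h M), so Z⁻¹ dominates the sum of (|x| + |y|)⁻² over
-- the nonzero points of the ℓ₁-ball of radius M in ℤ². The ℓ₁-sphere of radius N has 4N points, hence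
-- Z⁻¹ ≥ 4 H_M for the harmonic number H_M. On the other side M + 1 = ∏_{k=1}^{M} (1 + 1/k) ≤ exp H_M, which stays
-- inside the partial sums E_K of exp thanks to E_K(r) (1 + s) ≤ E_{K+1}(r + s). For M = ⌊(n − 1)/2⌋ this gives
-- n/2 ≤ M + 1 ≤ E_{M+1}(Z⁻¹/4) < E_{M+2}(Z⁻¹/4).

module Submission where

open import Defs
open import Data.Nat using (ℕ; _≤_)
open import Data.Integer using (+_)
open import Data.Rational using (_/_; _*_)

open import Data.Nat.Base as ℕ using (zero; suc; _∸_; _⊓_; ∣_-_∣; z≤n; s≤s; ⌊_/2⌋; ⌈_/2⌉; _!)
import Data.Nat.Properties as ℕ
import Data.Integer.Base as ℤ
import Data.Integer.Properties as ℤ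
open import Data.Rational.Base using (ℚ; 0ℚ; 1ℚ; _+_; _-_; -_; toℚᵘ; nonNegative; positive)
  renaming (_≤_ to _≤ℚ_; _<_ to _<ℚ_)
open import Data.Rational.Properties
import Data.Rational.Unnormalised.Base as ℚᵘ
import Data.Rational.Unnormalised.Properties as ℚᵘ
open import Data.Rational.Solver using (module +-*-Solver)
open import Data.Nat.Tactic.RingSolver using (solve-∀)
open import Data.Fin.Base using (Fin; toℕ)
open import Data.Fin.Properties using (toℕ<n)
open import Data.List.Base using (List; []; _∷_; map; _++_; concatMap; allFin; tabulate)
open import Data.List.Properties using (map-tabulate; map-cong; map-∘; map-concatMap)
open import Data.Product.Base using (_,_)
open import Function.Base using (_∘_)
open import Relation.Binary.PropositionalEquality

p≤p+q : ∀ p {q} → 0ℚ ≤ℚ q → p ≤ℚ p + q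
p≤p+q p q≥0 = ≤-trans (≤-reflexive (sym (+-identityʳ p))) (+-monoʳ-≤ p q≥0)

*-nonNeg : ∀ {p q} → 0ℚ ≤ℚ p → 0ℚ ≤ℚ q → 0ℚ ≤ℚ p * q
*-nonNeg {p} {q} p≥0 q≥0 =
  nonNegative⁻¹ _ {{nonNeg*nonNeg⇒nonNeg p {{nonNegative p≥0}} q {{nonNegative q≥0}}}}

*-pos : ∀ {p q} → 0ℚ <ℚ p → 0ℚ <ℚ q → 0ℚ <ℚ p * q
*-pos {p} {q} p>0 q>0 = positive⁻¹ _ {{pos*pos⇒pos p {{positive p>0}} q {{positive q>0}}}}

∑ : ℕ → (ℕ → ℚ) → ℚ
∑ zero    f = 0ℚ
∑ (suc m) f = f 0 + ∑ m (f ∘ suc)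

syntax ∑ m (λ k → e) = ∑[ k < m ] e

∑-cong : ∀ m {f g : ℕ → ℚ} → (∀ k → k ℕ.< m → f k ≡ g k) → ∑ m f ≡ ∑ m g
∑-cong zero    f≗g = refl
∑-cong (suc m) f≗g = cong₂ _+_ (f≗g 0 ℕ.z<s) (∑-cong m (λ k k<m → f≗g (suc k) (s≤s k<m)))

∑-mono-≤ : ∀ m {f g : ℕ → ℚ} → (∀ k → k ℕ.< m → f k ≤ℚ g k) → ∑ m f ≤ℚ ∑ m g
∑-mono-≤ zero    f≤g = ≤-refl
∑-mono-≤ (suc m) f≤g = +-mono-≤ (f≤g 0 ℕ.z<s) (∑-mono-≤ m (λ k k<m → f≤g (suc k) (s≤s k<m)))

∑-nonNeg : ∀ m {f : ℕ → ℚ} → (∀ k → 0ℚ ≤ℚ f k) → 0ℚ ≤ℚ ∑ m f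
∑-nonNeg zero    f≥0 = ≤-refl
∑-nonNeg (suc m) f≥0 = +-mono-≤ (f≥0 0) (∑-nonNeg m (f≥0 ∘ suc))

∑-split : ∀ p q (f : ℕ → ℚ) → ∑ (p ℕ.+ q) f ≡ ∑ p f + ∑[ k < q ] f (p ℕ.+ k)
∑-split zero    q f = sym (+-identityˡ _)
∑-split (suc p) q f = trans (cong (_+_ (f 0)) (∑-split p q (f ∘ suc))) (sym (+-assoc (f 0) _ _))

∑-snoc : ∀ m (f : ℕ → ℚ) → ∑ (suc m) f ≡ ∑ m f + f m
∑-snoc zero    f = trans (+-identityʳ (f 0)) (sym (+-identityˡ (f 0)))
∑-snoc (suc m) f = trans (cong (_+_ (f 0)) (∑-snoc m (f ∘ suc))) (sym (+-assoc (f 0) _ _))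

∑-distrib-+ : ∀ m (f g : ℕ → ℚ) → ∑[ k < m ] (f k + g k) ≡ ∑ m f + ∑ m g
∑-distrib-+ zero    f g = refl
∑-distrib-+ (suc m) f g =
  trans (cong (_+_ (f 0 + g 0)) (∑-distrib-+ m (f ∘ suc) (g ∘ suc))) (interchange (f 0) (g 0) _ _)
  where
  open +-*-Solver
  interchange : ∀ a b c d → (a + b) + (c + d) ≡ (a + c) + (b + d)
  interchange = solve 4 (λ a b c d → (a :+ b) :+ (c :+ d) := (a :+ c) :+ (b :+ d)) refl

*-distribˡ-∑ : ∀ m a (f : ℕ → ℚ) → a * ∑ m f ≡ ∑[ k < m ] (a * f k)
*-distribˡ-∑ zero    a f = *-zeroʳ a
*-distribˡ-∑ (suc m) a f =
  trans (*-distribˡ-+ a (f 0) _) (cong (_+_ (a * f 0)) (*-distribˡ-∑ m a (f ∘ suc)))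

*-distribʳ-∑ : ∀ m a (f : ℕ → ℚ) → ∑ m f * a ≡ ∑[ k < m ] (f k * a)
*-distribʳ-∑ m a f =
  trans (*-comm (∑ m f) a) (trans (*-distribˡ-∑ m a f) (∑-cong m (λ k _ → *-comm a (f k))))

∑-reverse : ∀ m (f : ℕ → ℚ) → ∑ m f ≡ ∑[ k < m ] f (m ∸ suc k)
∑-reverse zero    f = refl
∑-reverse (suc m) f = begin
  f 0 + ∑ m (f ∘ suc)                        ≡⟨ cong (_+_ (f 0)) (∑-reverse m (f ∘ suc)) ⟩
  f 0 + ∑[ k < m ] f (suc (m ∸ suc k))       ≡⟨ +-comm (f 0) _ ⟩
  ∑[ k < m ] f (suc (m ∸ suc k)) + f 0       ≡⟨ cong₂ _+_ (∑-cong m λ k k<m → cong f (ℕ.+-∸-assoc 1 k<m))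
                                                          (cong f (ℕ.n∸n≡0 m)) ⟨
  ∑[ k < m ] f (m ∸ k) + f (m ∸ m)           ≡⟨ ∑-snoc m (λ k → f (m ∸ k)) ⟨
  ∑[ k < suc m ] f (suc m ∸ suc k)           ∎
  where open ≡-Reasoning

∑-mono-≤-length : ∀ {m n} {f : ℕ → ℚ} → (∀ k → 0ℚ ≤ℚ f k) → m ℕ.≤ n → ∑ m f ≤ℚ ∑ n f
∑-mono-≤-length {m} {n} {f} f≥0 m≤n = begin
  ∑ m f                                  ≤⟨ p≤p+q (∑ m f) (∑-nonNeg (n ∸ m) (f≥0 ∘ (m ℕ.+_))) ⟩
  ∑ m f + ∑[ k < n ∸ m ] f (m ℕ.+ k)     ≡⟨ ∑-split m (n ∸ m) f ⟨
  ∑ (m ℕ.+ (n ∸ m)) f                    ≡⟨ cong (λ l → ∑ l f) (ℕ.m+[n∸m]≡n m≤n) ⟩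
  ∑ n f                                  ∎
  where open ≤-Reasoning

∑-triangle : ∀ m (F : ℕ → ℕ → ℚ) →
             ∑[ x < m ] ∑[ y < m ∸ x ] F x y ≡ ∑[ N < m ] ∑[ x < suc N ] F x (N ∸ x)
∑-triangle zero    F = refl
∑-triangle (suc m) F = begin
  ∑[ x < suc m ] ∑[ y < suc m ∸ x ] F x y
    ≡⟨ ∑-snoc m (λ x → ∑[ y < suc m ∸ x ] F x y) ⟩
  ∑[ x < m ] ∑[ y < suc m ∸ x ] F x y + ∑[ y < suc m ∸ m ] F m y
    ≡⟨ cong₂ _+_ (∑-cong m (λ x x<m → peel x (ℕ.<⇒≤ x<m))) (peel m ℕ.≤-refl) ⟩
  ∑[ x < m ] (∑[ y < m ∸ x ] F x y + F x (m ∸ x)) + (∑[ y < m ∸ m ] F m y + F m (m ∸ m))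
    ≡⟨ cong₂ _+_ (∑-distrib-+ m _ _) (cong (λ l → ∑ l (F m) + F m (m ∸ m)) (ℕ.n∸n≡0 m)) ⟩
  (∑[ x < m ] ∑[ y < m ∸ x ] F x y + ∑[ x < m ] F x (m ∸ x)) + (0ℚ + F m (m ∸ m))
    ≡⟨ cong (_+_ (∑[ x < m ] ∑[ y < m ∸ x ] F x y + ∑[ x < m ] F x (m ∸ x)))
            (+-identityˡ (F m (m ∸ m))) ⟩
  (∑[ x < m ] ∑[ y < m ∸ x ] F x y + ∑[ x < m ] F x (m ∸ x)) + F m (m ∸ m)
    ≡⟨ +-assoc (∑[ x < m ] ∑[ y < m ∸ x ] F x y) _ _ ⟩
  ∑[ x < m ] ∑[ y < m ∸ x ] F x y + (∑[ x < m ] F x (m ∸ x) + F m (m ∸ m))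
    ≡⟨ cong₂ _+_ (∑-triangle m F) (sym (∑-snoc m (λ x → F x (m ∸ x)))) ⟩
  ∑[ N < m ] ∑[ x < suc N ] F x (N ∸ x) + ∑[ x < suc m ] F x (m ∸ x)
    ≡⟨ ∑-snoc m (λ N → ∑[ x < suc N ] F x (N ∸ x)) ⟨
  ∑[ N < suc m ] ∑[ x < suc N ] F x (N ∸ x)
    ∎
  where
  open ≡-Reasoning
  peel : ∀ x → x ℕ.≤ m → ∑[ y < suc m ∸ x ] F x y ≡ ∑[ y < m ∸ x ] F x y + F x (m ∸ x)
  peel x x≤m = trans (cong (λ l → ∑ l (F x)) (ℕ.+-∸-assoc 1 x≤m)) (∑-snoc (m ∸ x) (F x))

fromℕ : ℕ → ℚ
fromℕ k = + k / 1

toℚᵘ-/ : ∀ a b .{{_ : ℕ.NonZero b}} → toℚᵘ (+ a / b) ℚᵘ.≃ (+ a) ℚᵘ./ b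
toℚᵘ-/ a (suc b) = toℚᵘ-fromℚᵘ (ℚᵘ.mkℚᵘ (+ a) b)

/-≡-/ : ∀ a b c d .{{_ : ℕ.NonZero b}} .{{_ : ℕ.NonZero d}} →
        a ℕ.* d ≡ c ℕ.* b → + a / b ≡ + c / d
/-≡-/ a b@(suc _) c d@(suc _) ad≡cb = toℚᵘ-injective (ℚᵘ.≃-trans (toℚᵘ-/ a b)
  (ℚᵘ.≃-trans (ℚᵘ.*≡* (trans (sym (ℤ.pos-* a d)) (trans (cong +_ ad≡cb) (ℤ.pos-* c b))))
               (ℚᵘ.≃-sym (toℚᵘ-/ c d))))

/-≤-/ : ∀ a b c d .{{_ : ℕ.NonZero b}} .{{_ : ℕ.NonZero d}} →
        a ℕ.* d ℕ.≤ c ℕ.* b → + a / b ≤ℚ + c / d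
/-≤-/ a b@(suc _) c d@(suc _) ad≤cb = toℚᵘ-cancel-≤
  (ℚᵘ.≤-respˡ-≃ (ℚᵘ.≃-sym (toℚᵘ-/ a b)) (ℚᵘ.≤-respʳ-≃ (ℚᵘ.≃-sym (toℚᵘ-/ c d))
    (ℚᵘ.*≤* (subst₂ ℤ._≤_ (ℤ.pos-* a d) (ℤ.pos-* c b) (ℤ.+≤+ ad≤cb)))))

/-*-/ : ∀ a b c d .{{_ : ℕ.NonZero b}} .{{_ : ℕ.NonZero d}} →
        (+ a / b) * (+ c / d) ≡ (+ (a ℕ.* c) / (b ℕ.* d)) {{ℕ.m*n≢0 b d}}
/-*-/ a b@(suc _) c d@(suc _) = toℚᵘ-injective (ℚᵘ.≃-trans (toℚᵘ-homo-* (+ a / b) (+ c / d))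
  (ℚᵘ.≃-trans (ℚᵘ.*-cong (toℚᵘ-/ a b) (toℚᵘ-/ c d))
    (ℚᵘ.≃-trans (ℚᵘ.*≡* (cong (ℤ._* + (b ℕ.* d)) (sym (ℤ.pos-* a c))))
      (ℚᵘ.≃-sym (toℚᵘ-/ (a ℕ.* c) (b ℕ.* d))))))

/-+-/ : ∀ a b c d .{{_ : ℕ.NonZero b}} .{{_ : ℕ.NonZero d}} →
        (+ a / b) + (+ c / d) ≡ (+ (a ℕ.* d ℕ.+ c ℕ.* b) / (b ℕ.* d)) {{ℕ.m*n≢0 b d}}
/-+-/ a b@(suc _) c d@(suc _) = toℚᵘ-injective (ℚᵘ.≃-trans (toℚᵘ-homo-+ (+ a / b) (+ c / d))
  (ℚᵘ.≃-trans (ℚᵘ.+-cong (toℚᵘ-/ a b) (toℚᵘ-/ c d))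
    (ℚᵘ.≃-trans (ℚᵘ.*≡* (cong (ℤ._* + (b ℕ.* d)) numerator))
      (ℚᵘ.≃-sym (toℚᵘ-/ (a ℕ.* d ℕ.+ c ℕ.* b) (b ℕ.* d))))))
  where
  numerator : + a ℤ.* + d ℤ.+ + c ℤ.* + b ≡ + (a ℕ.* d ℕ.+ c ℕ.* b)
  numerator = sym (trans (ℤ.pos-+ (a ℕ.* d) (c ℕ.* b)) (cong₂ ℤ._+_ (ℤ.pos-* a d) (ℤ.pos-* c b)))

*-/≡/ : ∀ a b c d e f .{{_ : ℕ.NonZero b}} .{{_ : ℕ.NonZero d}} .{{_ : ℕ.NonZero f}} →
        a ℕ.* c ℕ.* f ≡ e ℕ.* (b ℕ.* d) → (+ a / b) * (+ c / d) ≡ + e / f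
*-/≡/ a b@(suc _) c d@(suc _) e f eq = trans (/-*-/ a b c d) (/-≡-/ (a ℕ.* c) (b ℕ.* d) e f eq)

+-/≡/ : ∀ a b c d e f .{{_ : ℕ.NonZero b}} .{{_ : ℕ.NonZero d}} .{{_ : ℕ.NonZero f}} →
        (a ℕ.* d ℕ.+ c ℕ.* b) ℕ.* f ≡ e ℕ.* (b ℕ.* d) → (+ a / b) + (+ c / d) ≡ + e / f
+-/≡/ a b@(suc _) c d@(suc _) e f eq =
  trans (/-+-/ a b c d) (/-≡-/ (a ℕ.* d ℕ.+ c ℕ.* b) (b ℕ.* d) e f eq)

fromℕ-suc : ∀ k → fromℕ (suc k) ≡ 1ℚ + fromℕ k
fromℕ-suc k = sym (+-/≡/ 1 1 k 1 (suc k) 1 (lemma k))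
  where
  lemma : ∀ k → (1 ℕ.* 1 ℕ.+ k ℕ.* 1) ℕ.* 1 ≡ suc k ℕ.* (1 ℕ.* 1)
  lemma = solve-∀

fromℕ-nonNeg : ∀ k → 0ℚ ≤ℚ fromℕ k
fromℕ-nonNeg k = nonNegative⁻¹ (fromℕ k) {{normalize-nonNeg k 1}}

fromℕ-*-1/ : ∀ k → fromℕ (suc k) * (+ 1 / suc k) ≡ 1ℚ
fromℕ-*-1/ k = *-/≡/ (suc k) 1 1 (suc k) 1 1 (lemma k)
  where
  lemma : ∀ k → suc k ℕ.* 1 ℕ.* 1 ≡ 1 ℕ.* (1 ℕ.* suc k)
  lemma = solve-∀

fromℕ-*-invSq : ∀ k → fromℕ (suc k) * invSq (suc k) ≡ + 1 / suc k
fromℕ-*-invSq k = *-/≡/ (suc k) 1 1 (suc k ℕ.* suc k) 1 (suc k) (lemma k)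
  where
  lemma : ∀ k → suc k ℕ.* 1 ℕ.* suc k ≡ 1 ℕ.* (1 ℕ.* (suc k ℕ.* suc k))
  lemma = solve-∀

invFact-suc : ∀ j → invFact (suc j) * fromℕ (suc j) ≡ invFact j
invFact-suc j = *-/≡/ 1 (suc j !) (suc j) 1 1 (j !) {{suc j ℕ.!≢0}} {{_}} {{j ℕ.!≢0}} (lemma j (j !))
  where
  lemma : ∀ j x → 1 ℕ.* suc j ℕ.* x ≡ 1 ℕ.* (suc j ℕ.* x ℕ.* 1)
  lemma = solve-∀

∑-const : ∀ m c → ∑[ k < m ] c ≡ fromℕ m * c
∑-const zero    c = sym (*-zeroˡ c)
∑-const (suc m) c = begin
  c + ∑[ k < m ] c          ≡⟨ cong (_+_ c) (∑-const m c) ⟩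
  c + fromℕ m * c           ≡⟨ cong (_+ fromℕ m * c) (*-identityˡ c) ⟨
  1ℚ * c + fromℕ m * c      ≡⟨ *-distribʳ-+ c 1ℚ (fromℕ m) ⟨
  (1ℚ + fromℕ m) * c        ≡⟨ cong (_* c) (fromℕ-suc m) ⟨
  fromℕ (suc m) * c         ∎
  where open ≡-Reasoning

powℚ-nonNeg : ∀ {r} j → 0ℚ ≤ℚ r → 0ℚ ≤ℚ powℚ r j
powℚ-nonNeg zero    r≥0 = nonNegative⁻¹ 1ℚ
powℚ-nonNeg (suc j) r≥0 = *-nonNeg r≥0 (powℚ-nonNeg j r≥0)

powℚ-pos : ∀ {r} j → 0ℚ <ℚ r → 0ℚ <ℚ powℚ r j
powℚ-pos zero    r>0 = positive⁻¹ 1ℚ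
powℚ-pos (suc j) r>0 = *-pos r>0 (powℚ-pos j r>0)

invFact-pos : ∀ j → 0ℚ <ℚ invFact j
invFact-pos j = positive⁻¹ _ {{normalize-pos 1 (j !) {{j ℕ.!≢0}}}}

powℚ-+-≥ : ∀ {r s} → 0ℚ ≤ℚ r → 0ℚ ≤ℚ s → ∀ j →
           powℚ r (suc j) + fromℕ (suc j) * s * powℚ r j ≤ℚ powℚ (r + s) (suc j)
powℚ-+-≥ {r} {s} r≥0 s≥0 zero = ≤-reflexive (lemma r s)
  where
  open +-*-Solver
  lemma : ∀ r s → r * 1ℚ + 1ℚ * s * 1ℚ ≡ (r + s) * 1ℚ
  lemma = solve 2 (λ r s → r :* con 1ℚ :+ con 1ℚ :* s :* con 1ℚ := (r :+ s) :* con 1ℚ) refl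
powℚ-+-≥ {r} {s} r≥0 s≥0 (suc j) = begin
  r * (r * P) + fromℕ (2 ℕ.+ j) * s * (r * P)
    ≡⟨ cong (λ i → r * (r * P) + i * s * (r * P)) (fromℕ-suc (suc j)) ⟩
  r * (r * P) + (1ℚ + I) * s * (r * P)
    ≤⟨ p≤p+q _ (*-nonNeg (*-nonNeg (*-nonNeg (fromℕ-nonNeg (suc j)) s≥0) s≥0) (powℚ-nonNeg j r≥0)) ⟩
  r * (r * P) + (1ℚ + I) * s * (r * P) + I * s * s * P
    ≡⟨ lemma r s P I ⟩
  (r + s) * (r * P + I * s * P)
    ≤⟨ *-monoˡ-≤-nonNeg (r + s) {{nonNegative (+-mono-≤ r≥0 s≥0)}} (powℚ-+-≥ r≥0 s≥0 j) ⟩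
  (r + s) * powℚ (r + s) (suc j)
    ∎
  where
  open ≤-Reasoning
  open +-*-Solver
  P = powℚ r j
  I = fromℕ (suc j)
  lemma : ∀ r s P I →
          r * (r * P) + (1ℚ + I) * s * (r * P) + I * s * s * P ≡ (r + s) * (r * P + I * s * P)
  lemma = solve 4 (λ r s P I → r :* (r :* P) :+ (con 1ℚ :+ I) :* s :* (r :* P) :+ I :* s :* s :* P
                               := (r :+ s) :* (r :* P :+ I :* s :* P)) refl

expTerm : ℚ → ℕ → ℚ
expTerm r j = powℚ r j * invFact j

expTerm-nonNeg : ∀ {r} j → 0ℚ ≤ℚ r → 0ℚ ≤ℚ expTerm r j
expTerm-nonNeg j r≥0 = *-nonNeg (powℚ-nonNeg j r≥0) (<⇒≤ (invFact-pos j))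

expPartial-nonNeg : ∀ {r} K → 0ℚ ≤ℚ r → 0ℚ ≤ℚ expPartial r K
expPartial-nonNeg zero    r≥0 = ≤-refl
expPartial-nonNeg (suc K) r≥0 = +-mono-≤ (expPartial-nonNeg K r≥0) (expTerm-nonNeg K r≥0)

expTerm-+-≥ : ∀ {r s} → 0ℚ ≤ℚ r → 0ℚ ≤ℚ s → ∀ j →
              expTerm r (suc j) + s * expTerm r j ≤ℚ expTerm (r + s) (suc j)
expTerm-+-≥ {r} {s} r≥0 s≥0 j = begin
  expTerm r (suc j) + s * (powℚ r j * invFact j)
    ≡⟨ cong (λ f → expTerm r (suc j) + s * (powℚ r j * f)) (sym (invFact-suc j)) ⟩
  powℚ r (suc j) * F + s * (powℚ r j * (F * fromℕ (suc j)))
    ≡⟨ lemma (powℚ r (suc j)) s (powℚ r j) F (fromℕ (suc j)) ⟩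
  (powℚ r (suc j) + fromℕ (suc j) * s * powℚ r j) * F
    ≤⟨ *-monoʳ-≤-nonNeg F {{nonNegative (<⇒≤ (invFact-pos (suc j)))}} (powℚ-+-≥ r≥0 s≥0 j) ⟩
  expTerm (r + s) (suc j)
    ∎
  where
  open ≤-Reasoning
  open +-*-Solver
  F = invFact (suc j)
  lemma : ∀ A s P F I → A * F + s * (P * (F * I)) ≡ (A + I * s * P) * F
  lemma = solve 5 (λ A s P F I → A :* F :+ s :* (P :* (F :* I)) := (A :+ I :* s :* P) :* F) refl

expPartial-+-≥ : ∀ {r s} → 0ℚ ≤ℚ r → 0ℚ ≤ℚ s → ∀ K →
                 expPartial r (suc K) + s * expPartial r K ≤ℚ expPartial (r + s) (suc K)
expPartial-+-≥ {r} {s} r≥0 s≥0 zero = ≤-reflexive (lemma s (invFact 0))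
  where
  open +-*-Solver
  lemma : ∀ s c → 0ℚ + 1ℚ * c + s * 0ℚ ≡ 0ℚ + 1ℚ * c
  lemma = solve 2 (λ s c → con 0ℚ :+ con 1ℚ :* c :+ s :* con 0ℚ := con 0ℚ :+ con 1ℚ :* c) refl
expPartial-+-≥ {r} {s} r≥0 s≥0 (suc K) = begin
  expPartial r (suc K) + expTerm r (suc K) + s * (expPartial r K + expTerm r K)
    ≡⟨ lemma (expPartial r K) (expTerm r K) (expTerm r (suc K)) s ⟩
  (expPartial r (suc K) + s * expPartial r K) + (expTerm r (suc K) + s * expTerm r K)
    ≤⟨ +-mono-≤ (expPartial-+-≥ r≥0 s≥0 K) (expTerm-+-≥ r≥0 s≥0 K) ⟩
  expPartial (r + s) (suc (suc K))
    ∎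
  where
  open ≤-Reasoning
  open +-*-Solver
  lemma : ∀ e a b s → e + a + b + s * (e + a) ≡ (e + a + s * e) + (b + s * a)
  lemma = solve 4 (λ e a b s → e :+ a :+ b :+ s :* (e :+ a) := (e :+ a :+ s :* e) :+ (b :+ s :* a)) refl

-- A finitary form of exp r · (1 + s) ≤ exp (r + s).
expPartial-*-1+ : ∀ {r s} → 0ℚ ≤ℚ r → 0ℚ ≤ℚ s → ∀ K →
                  expPartial r K * (1ℚ + s) ≤ℚ expPartial (r + s) (suc K)
expPartial-*-1+ {r} {s} r≥0 s≥0 K = begin
  expPartial r K * (1ℚ + s)                  ≡⟨ lemma (expPartial r K) s ⟩
  expPartial r K + s * expPartial r K        ≤⟨ +-monoˡ-≤ _ (p≤p+q (expPartial r K) (expTerm-nonNeg K r≥0)) ⟩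
  expPartial r (suc K) + s * expPartial r K  ≤⟨ expPartial-+-≥ r≥0 s≥0 K ⟩
  expPartial (r + s) (suc K)                 ∎
  where
  open ≤-Reasoning
  open +-*-Solver
  lemma : ∀ e s → e * (1ℚ + s) ≡ e + s * e
  lemma = solve 2 (λ e s → e :* (con 1ℚ :+ s) := e :+ s :* e) refl

expPartial-mono-≤ : ∀ {r r′} → 0ℚ ≤ℚ r → r ≤ℚ r′ → ∀ K → expPartial r K ≤ℚ expPartial r′ K
expPartial-mono-≤ r≥0 r≤r′ zero = ≤-refl
expPartial-mono-≤ {r} {r′} r≥0 r≤r′ (suc K) = begin
  expPartial r (suc K)                       ≤⟨ p≤p+q _ (*-nonNeg s≥0 (expPartial-nonNeg K r≥0)) ⟩
  expPartial r (suc K) + s * expPartial r K  ≤⟨ expPartial-+-≥ r≥0 s≥0 K ⟩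
  expPartial (r + s) (suc K)                 ≡⟨ cong (λ x → expPartial x (suc K)) (lemma r r′) ⟩
  expPartial r′ (suc K)                      ∎
  where
  open ≤-Reasoning
  open +-*-Solver
  s = r′ - r
  s≥0 : 0ℚ ≤ℚ s
  s≥0 = ≤-trans (≤-reflexive (sym (+-inverseʳ r))) (+-monoˡ-≤ (- r) r≤r′)
  lemma : ∀ r r′ → r + (r′ - r) ≡ r′
  lemma = solve 2 (λ r r′ → r :+ (r′ :- r) := r′) refl

expPartial-<-suc : ∀ {r} K → 0ℚ <ℚ r → expPartial r K <ℚ expPartial r (suc K)
expPartial-<-suc {r} K r>0 = ≤-<-trans (≤-reflexive (sym (+-identityʳ (expPartial r K))))
  (+-monoʳ-< (expPartial r K) (*-pos (powℚ-pos K r>0) (invFact-pos K)))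

harmonic : ℕ → ℚ
harmonic M = ∑[ k < M ] (+ 1 / suc k)

1/suc-nonNeg : ∀ k → 0ℚ ≤ℚ + 1 / suc k
1/suc-nonNeg k = nonNegative⁻¹ _ {{normalize-nonNeg 1 (suc k)}}

harmonic-nonNeg : ∀ M → 0ℚ ≤ℚ harmonic M
harmonic-nonNeg M = ∑-nonNeg M 1/suc-nonNeg

harmonic-pos : ∀ M → 0ℚ <ℚ harmonic (suc M)
harmonic-pos M = <-≤-trans (positive⁻¹ 1ℚ) (p≤p+q 1ℚ (∑-nonNeg M (1/suc-nonNeg ∘ suc)))

fromℕ-≤-expPartial-harmonic : ∀ M → fromℕ (suc M) ≤ℚ expPartial (harmonic M) (suc M)
fromℕ-≤-expPartial-harmonic zero    = ≤-refl
fromℕ-≤-expPartial-harmonic (suc M) = begin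
  fromℕ (2 ℕ.+ M)                                 ≡⟨ fromℕ-suc (suc M) ⟩
  1ℚ + m                                          ≡⟨ cong (_+ m) (sym (fromℕ-*-1/ M)) ⟩
  m * s + m                                       ≡⟨ lemma m s ⟩
  m * (1ℚ + s)                                    ≤⟨ *-monoʳ-≤-nonNeg (1ℚ + s) {{nonNegative 1+s≥0}}
                                                                      (fromℕ-≤-expPartial-harmonic M) ⟩
  expPartial (harmonic M) (suc M) * (1ℚ + s)      ≤⟨ expPartial-*-1+ (harmonic-nonNeg M) s≥0 (suc M) ⟩
  expPartial (harmonic M + s) (2 ℕ.+ M)           ≡⟨ cong (λ h → expPartial h (2 ℕ.+ M))
                                                           (∑-snoc M (λ k → + 1 / suc k)) ⟨
  expPartial (harmonic (suc M)) (2 ℕ.+ M)         ∎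
  where
  open ≤-Reasoning
  open +-*-Solver
  m = fromℕ (suc M)
  s = + 1 / suc M
  s≥0 : 0ℚ ≤ℚ s
  s≥0 = 1/suc-nonNeg M
  1+s≥0 : 0ℚ ≤ℚ 1ℚ + s
  1+s≥0 = +-mono-≤ (nonNegative⁻¹ 1ℚ) s≥0
  lemma : ∀ m s → m * s + m ≡ m * (1ℚ + s)
  lemma = solve 2 (λ m s → m :* s :+ m := m :* (con 1ℚ :+ s)) refl

cyclic : ℕ → ℕ → ℕ
cyclic n k = k ⊓ (n ∸ k)

cyclic-reflect : ∀ {n k} → k ℕ.≤ n → cyclic n (n ∸ k) ≡ cyclic n k
cyclic-reflect {n} {k} k≤n = trans (cong (λ j → (n ∸ k) ⊓ j) (ℕ.m∸[m∸n]≡n k≤n)) (ℕ.⊓-comm (n ∸ k) k)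

cyclic-low : ∀ {n k} → k ℕ.+ k ℕ.≤ n → cyclic n k ≡ k
cyclic-low {n} {k} 2k≤n = ℕ.m≤n⇒m⊓n≡m (ℕ.m+n≤o⇒m≤o∸n k 2k≤n)

cyclic-high : ∀ {n k} → n ∸ k ℕ.≤ k → cyclic n k ≡ n ∸ k
cyclic-high = ℕ.m≥n⇒m⊓n≡n

∑c∣a-i∣≡∑c : ∀ {n a} (c : ℕ → ℚ) → (∀ k → k ℕ.≤ n → c (n ∸ k) ≡ c k) → a ℕ.≤ n →
             ∑[ i < n ] c ∣ a - i ∣ ≡ ∑ n c
∑c∣a-i∣≡∑c {n} {a} c c-reflect a≤n = begin
  ∑[ i < n ] c ∣ a - i ∣                                   ≡⟨ cong (λ l → ∑[ i < l ] c ∣ a - i ∣) a+q≡n ⟨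
  ∑[ i < a ℕ.+ q ] c ∣ a - i ∣                             ≡⟨ ∑-split a q (λ i → c ∣ a - i ∣) ⟩
  ∑[ i < a ] c ∣ a - i ∣ + ∑[ k < q ] c ∣ a - a ℕ.+ k ∣    ≡⟨ cong₂ _+_ (∑-cong a below)
                                                                (∑-cong q (λ k _ → cong c (ℕ.∣m-m+n∣≡n a k))) ⟩
  ∑[ i < a ] c (q ℕ.+ i) + ∑ q c                           ≡⟨ +-comm _ (∑ q c) ⟩
  ∑ q c + ∑[ i < a ] c (q ℕ.+ i)                           ≡⟨ ∑-split q a c ⟨
  ∑ (q ℕ.+ a) c                                            ≡⟨ cong (λ l → ∑ l c) (ℕ.+-comm q a) ⟩
  ∑ (a ℕ.+ q) c                                            ≡⟨ cong (λ l → ∑ l c) a+q≡n ⟩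
  ∑ n c                                                    ∎
  where
  open ≡-Reasoning
  q = n ∸ a
  a+q≡n : a ℕ.+ q ≡ n
  a+q≡n = ℕ.m+[n∸m]≡n a≤n
  below : ∀ i → i ℕ.< a → c ∣ a - i ∣ ≡ c (q ℕ.+ i)
  below i i<a = begin
    c ∣ a - i ∣                 ≡⟨ cong c (trans (ℕ.∣-∣-comm a i) (ℕ.m≤n⇒∣m-n∣≡n∸m (ℕ.<⇒≤ i<a))) ⟩
    c (a ∸ i)                   ≡⟨ c-reflect (a ∸ i) (ℕ.≤-trans (ℕ.m∸n≤m a i) a≤n) ⟨
    c (n ∸ (a ∸ i))             ≡⟨ cong c n∸[a∸i]≡q+i ⟩
    c (q ℕ.+ i)                 ∎
    where
    n∸[a∸i]≡q+i : n ∸ (a ∸ i) ≡ q ℕ.+ i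
    n∸[a∸i]≡q+i = begin
      n ∸ (a ∸ i)               ≡⟨ cong (_∸ (a ∸ i)) (trans (sym a+q≡n) (ℕ.+-comm a q)) ⟩
      (q ℕ.+ a) ∸ (a ∸ i)       ≡⟨ ℕ.+-∸-assoc q (ℕ.m∸n≤m a i) ⟩
      q ℕ.+ (a ∸ (a ∸ i))       ≡⟨ cong (q ℕ.+_) (ℕ.m∸[m∸n]≡n (ℕ.<⇒≤ i<a)) ⟩
      q ℕ.+ i                   ∎

weight : ℕ → ℚ
weight zero    = 1ℚ
weight (suc _) = fromℕ 2

weight-nonNeg : ∀ k → 0ℚ ≤ℚ weight k
weight-nonNeg zero    = nonNegative⁻¹ 1ℚ
weight-nonNeg (suc _) = fromℕ-nonNeg 2

-- weighted M h = h 0 + 2 (h 1 + ⋯ + h M) is the sum of h ∣j∣ over −M ≤ j ≤ M.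
weighted : ℕ → (ℕ → ℚ) → ℚ
weighted M h = ∑[ k < suc M ] (weight k * h k)

weighted-nonNeg : ∀ M {h : ℕ → ℚ} → (∀ k → 0ℚ ≤ℚ h k) → 0ℚ ≤ℚ weighted M h
weighted-nonNeg M h≥0 = ∑-nonNeg (suc M) (λ k → *-nonNeg (weight-nonNeg k) (h≥0 k))

weighted-split : ∀ M (h : ℕ → ℚ) → weighted M h ≡ ∑[ k < suc M ] h k + ∑[ k < M ] h (suc k)
weighted-split M h = begin
  1ℚ * h 0 + ∑[ k < M ] (fromℕ 2 * h (suc k))
    ≡⟨ cong₂ _+_ (*-identityˡ (h 0)) (∑-cong M (λ k _ → double (h (suc k)))) ⟩
  h 0 + ∑[ k < M ] (h (suc k) + h (suc k))
    ≡⟨ cong (_+_ (h 0)) (∑-distrib-+ M (h ∘ suc) (h ∘ suc)) ⟩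
  h 0 + (∑[ k < M ] h (suc k) + ∑[ k < M ] h (suc k))
    ≡⟨ +-assoc (h 0) _ _ ⟨
  ∑[ k < suc M ] h k + ∑[ k < M ] h (suc k)
    ∎
  where
  open ≡-Reasoning
  open +-*-Solver
  double : ∀ x → fromℕ 2 * x ≡ x + x
  double = solve 1 (λ x → con (fromℕ 2) :* x := x :+ x) refl

-- The first M + 1 terms of the cyclic sum are h 0, …, h M and its last M terms are h M, …, h 1.
weighted≤∑cyclic : ∀ {n} M (h : ℕ → ℚ) → (∀ k → 0ℚ ≤ℚ h k) → M ℕ.+ M ℕ.< n →
                   weighted M h ≤ℚ ∑[ k < n ] h (cyclic n k)
weighted≤∑cyclic {n} M h h≥0 2M<n = begin
  weighted M h
    ≡⟨ weighted-split M h ⟩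
  ∑[ k < suc M ] h k + ∑[ k < M ] h (suc k)
    ≡⟨ cong (_+_ (∑[ k < suc M ] h k)) (∑-reverse M (h ∘ suc)) ⟩
  ∑[ k < suc M ] h k + ∑[ k < M ] h (suc (M ∸ suc k))
    ≡⟨ cong₂ _+_ (∑-cong (suc M) (λ k k≤M → cong h (sym (cyclic-low {n} {k} (2k≤n k≤M)))))
                 (∑-cong M (λ k k<M → cong h (sym (cyclic-tail k k<M)))) ⟩
  ∑[ k < suc M ] c k + ∑[ k < M ] c (X ℕ.+ k)
    ≤⟨ +-monoˡ-≤ _ (∑-mono-≤-length (h≥0 ∘ cyclic n) (ℕ.m≤m+n (suc M) _)) ⟩
  ∑ X c + ∑[ k < M ] c (X ℕ.+ k)
    ≡⟨ ∑-split X M c ⟨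
  ∑ (X ℕ.+ M) c
    ≡⟨ cong (λ l → ∑ l c) X+M≡n ⟩
  ∑ n c
    ∎
  where
  open ≤-Reasoning
  c : ℕ → ℚ
  c k = h (cyclic n k)
  X = suc M ℕ.+ (n ∸ suc (M ℕ.+ M))
  X+M≡n : X ℕ.+ M ≡ n
  X+M≡n = trans (lemma M (n ∸ suc (M ℕ.+ M))) (ℕ.m+[n∸m]≡n 2M<n)
    where
    lemma : ∀ M r → suc M ℕ.+ r ℕ.+ M ≡ suc (M ℕ.+ M) ℕ.+ r
    lemma = solve-∀
  2k≤n : ∀ {k} → k ℕ.< suc M → k ℕ.+ k ℕ.≤ n
  2k≤n (s≤s k≤M) = ℕ.≤-trans (ℕ.+-mono-≤ k≤M k≤M) (ℕ.<⇒≤ 2M<n)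
  cyclic-tail : ∀ k → k ℕ.< M → cyclic n (X ℕ.+ k) ≡ suc (M ∸ suc k)
  cyclic-tail k k<M = trans (cyclic-high {n} (ℕ.≤-trans n∸[X+k]≤M (ℕ.≤-trans M≤X (ℕ.m≤m+n X k))))
                            (trans n∸[X+k]≡M∸k (ℕ.+-∸-assoc 1 k<M))
    where
    M≤X : M ℕ.≤ X
    M≤X = ℕ.≤-trans (ℕ.n≤1+n M) (ℕ.m≤m+n (suc M) _)
    n∸[X+k]≡M∸k : n ∸ (X ℕ.+ k) ≡ M ∸ k
    n∸[X+k]≡M∸k = trans (cong (_∸ (X ℕ.+ k)) (sym X+M≡n)) (ℕ.[m+n]∸[m+o]≡n∸o X M k)
    n∸[X+k]≤M : n ∸ (X ℕ.+ k) ℕ.≤ M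
    n∸[X+k]≤M = ℕ.≤-trans (ℕ.≤-reflexive n∸[X+k]≡M∸k) (ℕ.m∸n≤m M k)

weighted≤∑cyclic∣a-i∣ : ∀ {n a} M (h : ℕ → ℚ) → (∀ k → 0ℚ ≤ℚ h k) → M ℕ.+ M ℕ.< n → a ℕ.≤ n →
                        weighted M h ≤ℚ ∑[ i < n ] h (cyclic n ∣ a - i ∣)
weighted≤∑cyclic∣a-i∣ {n} M h h≥0 2M<n a≤n = ≤-trans (weighted≤∑cyclic M h h≥0 2M<n)
  (≤-reflexive (sym (∑c∣a-i∣≡∑c (h ∘ cyclic n) (λ k k≤n → cong h (cyclic-reflect k≤n)) a≤n)))

sumℚ-++ : ∀ xs ys → sumℚ (xs ++ ys) ≡ sumℚ xs + sumℚ ys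
sumℚ-++ []       ys = sym (+-identityˡ (sumℚ ys))
sumℚ-++ (x ∷ xs) ys = trans (cong (_+_ x) (sumℚ-++ xs ys)) (sym (+-assoc x (sumℚ xs) (sumℚ ys)))

sumℚ-concatMap : ∀ {A : Set} (f : A → List ℚ) xs → sumℚ (concatMap f xs) ≡ sumℚ (map (sumℚ ∘ f) xs)
sumℚ-concatMap f []       = refl
sumℚ-concatMap f (x ∷ xs) =
  trans (sumℚ-++ (f x) (concatMap f xs)) (cong (_+_ (sumℚ (f x))) (sumℚ-concatMap f xs))

sumℚ-tabulate : ∀ n (f : ℕ → ℚ) → sumℚ (tabulate {n = n} (f ∘ toℕ)) ≡ ∑ n f
sumℚ-tabulate zero    f = refl
sumℚ-tabulate (suc n) f = cong (_+_ (f 0)) (sumℚ-tabulate n (f ∘ suc))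

sumℚ-allFin : ∀ n (f : ℕ → ℚ) → sumℚ (map (f ∘ toℕ) (allFin n)) ≡ ∑ n f
sumℚ-allFin n f = trans (cong sumℚ (map-tabulate {n = n} (λ i → i) (f ∘ toℕ))) (sumℚ-tabulate n f)

Zinv≡∑∑ : ∀ n (a b : Fin n) →
          Zinv n (a , b) ≡ ∑[ k < n ] ∑[ l < n ] invSq (cyclic n ∣ toℕ a - k ∣ ℕ.+ cyclic n ∣ toℕ b - l ∣)
Zinv≡∑∑ n a b = begin
  sumℚ (map φ (concatMap row (allFin n)))
    ≡⟨ cong sumℚ (map-concatMap φ row (allFin n)) ⟩
  sumℚ (concatMap (map φ ∘ row) (allFin n))
    ≡⟨ sumℚ-concatMap (map φ ∘ row) (allFin n) ⟩
  sumℚ (map (λ i → sumℚ (map φ (row i))) (allFin n))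
    ≡⟨ cong sumℚ (map-cong (λ i → trans (cong sumℚ (sym (map-∘ (allFin n)))) (sumℚ-allFin n (g (toℕ i))))
                           (allFin n)) ⟩
  sumℚ (map (λ i → ∑ n (g (toℕ i))) (allFin n))
    ≡⟨ sumℚ-allFin n (λ k → ∑ n (g k)) ⟩
  ∑[ k < n ] ∑ n (g k)
    ∎
  where
  open ≡-Reasoning
  φ : Vertex n → ℚ
  φ v = invSq (dist n (a , b) v)
  row : Fin n → List (Vertex n)
  row i = map (i ,_) (allFin n)
  g : ℕ → ℕ → ℚ
  g k l = invSq (cyclic n ∣ toℕ a - k ∣ ℕ.+ cyclic n ∣ toℕ b - l ∣)

invSq-nonNeg : ∀ k → 0ℚ ≤ℚ invSq k
invSq-nonNeg zero    = ≤-refl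
invSq-nonNeg (suc k) = nonNegative⁻¹ _ {{normalize-nonNeg 1 (suc k ℕ.* suc k)}}

weighted²≤Zinv : ∀ {n} M (a b : Fin n) → M ℕ.+ M ℕ.< n →
                 weighted M (λ x → weighted M (λ y → invSq (x ℕ.+ y))) ≤ℚ Zinv n (a , b)
weighted²≤Zinv {n} M a b 2M<n = begin
  weighted M (λ x → weighted M (λ y → invSq (x ℕ.+ y)))
    ≤⟨ weighted≤∑cyclic∣a-i∣ M (λ x → weighted M (λ y → invSq (x ℕ.+ y)))
         (λ x → weighted-nonNeg M (λ y → invSq-nonNeg (x ℕ.+ y))) 2M<n (ℕ.<⇒≤ (toℕ<n a)) ⟩
  ∑[ k < n ] weighted M (λ y → invSq (dₐ k ℕ.+ y))
    ≤⟨ ∑-mono-≤ n (λ k _ → weighted≤∑cyclic∣a-i∣ M (λ y → invSq (dₐ k ℕ.+ y))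
         (λ y → invSq-nonNeg (dₐ k ℕ.+ y)) 2M<n (ℕ.<⇒≤ (toℕ<n b))) ⟩
  ∑[ k < n ] ∑[ l < n ] invSq (dₐ k ℕ.+ cyclic n ∣ toℕ b - l ∣)
    ≡⟨ Zinv≡∑∑ n a b ⟨
  Zinv n (a , b)
    ∎
  where
  open ≤-Reasoning
  dₐ : ℕ → ℕ
  dₐ k = cyclic n ∣ toℕ a - k ∣

-- weight x * weight y counts the points (±x, ±y) of ℤ², so this is the size 4N of the ℓ₁-sphere of radius N.
weight-convolution : ∀ N → ∑[ x < suc (suc N) ] (weight x * weight (suc N ∸ x)) ≡ fromℕ 4 * fromℕ (suc N)
weight-convolution N = begin
  1ℚ * fromℕ 2 + ∑[ x < suc N ] (fromℕ 2 * weight (N ∸ x))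
    ≡⟨ cong (_+_ (1ℚ * fromℕ 2)) (*-distribˡ-∑ (suc N) (fromℕ 2) (λ x → weight (N ∸ x))) ⟨
  1ℚ * fromℕ 2 + fromℕ 2 * ∑[ x < suc N ] weight (N ∸ x)
    ≡⟨ cong (λ s → 1ℚ * fromℕ 2 + fromℕ 2 * s)
            (trans (sym (∑-reverse (suc N) weight)) (cong (_+_ 1ℚ) (∑-const N (fromℕ 2)))) ⟩
  1ℚ * fromℕ 2 + fromℕ 2 * (1ℚ + fromℕ N * fromℕ 2)
    ≡⟨ lemma (fromℕ N) ⟩
  fromℕ 4 * (1ℚ + fromℕ N)
    ≡⟨ cong (fromℕ 4 *_) (fromℕ-suc N) ⟨
  fromℕ 4 * fromℕ (suc N)
    ∎
  where
  open ≡-Reasoning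
  open +-*-Solver
  lemma : ∀ i → 1ℚ * fromℕ 2 + fromℕ 2 * (1ℚ + i * fromℕ 2) ≡ fromℕ 4 * (1ℚ + i)
  lemma = solve 1 (λ i → con 1ℚ :* con (fromℕ 2) :+ con (fromℕ 2) :* (con 1ℚ :+ i :* con (fromℕ 2))
                         := con (fromℕ 4) :* (con 1ℚ :+ i)) refl

∑-ℓ₁-spheres : ∀ M → ∑[ N < suc M ] ∑[ x < suc N ] (weight x * (weight (N ∸ x) * invSq (x ℕ.+ (N ∸ x))))
                     ≡ fromℕ 4 * harmonic M
∑-ℓ₁-spheres M = begin
  0ℚ + ∑[ N < M ] sphere (suc N)          ≡⟨ +-identityˡ _ ⟩
  ∑[ N < M ] sphere (suc N)               ≡⟨ ∑-cong M (λ N _ → sphere-suc N) ⟩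
  ∑[ N < M ] (fromℕ 4 * (+ 1 / suc N))    ≡⟨ *-distribˡ-∑ M (fromℕ 4) (λ N → + 1 / suc N) ⟨
  fromℕ 4 * harmonic M                    ∎
  where
  open ≡-Reasoning
  sphere : ℕ → ℚ
  sphere N = ∑[ x < suc N ] (weight x * (weight (N ∸ x) * invSq (x ℕ.+ (N ∸ x))))
  sphere-suc : ∀ N → sphere (suc N) ≡ fromℕ 4 * (+ 1 / suc N)
  sphere-suc N = begin
    sphere (suc N)
      ≡⟨ ∑-cong (2 ℕ.+ N) (λ x x≤1+N → trans
           (cong (λ d → weight x * (weight (suc N ∸ x) * invSq d)) (ℕ.m+[n∸m]≡n (ℕ.≤-pred x≤1+N)))
           (sym (*-assoc (weight x) (weight (suc N ∸ x)) (invSq (suc N))))) ⟩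
    ∑[ x < 2 ℕ.+ N ] (weight x * weight (suc N ∸ x) * invSq (suc N))
      ≡⟨ *-distribʳ-∑ (2 ℕ.+ N) (invSq (suc N)) (λ x → weight x * weight (suc N ∸ x)) ⟨
    ∑[ x < 2 ℕ.+ N ] (weight x * weight (suc N ∸ x)) * invSq (suc N)
      ≡⟨ cong (_* invSq (suc N)) (weight-convolution N) ⟩
    fromℕ 4 * fromℕ (suc N) * invSq (suc N)
      ≡⟨ *-assoc (fromℕ 4) (fromℕ (suc N)) (invSq (suc N)) ⟩
    fromℕ 4 * (fromℕ (suc N) * invSq (suc N))
      ≡⟨ cong (fromℕ 4 *_) (fromℕ-*-invSq N) ⟩
    fromℕ 4 * (+ 1 / suc N)
      ∎

4*harmonic≤weighted² : ∀ M →
                       fromℕ 4 * harmonic M ≤ℚ weighted M (λ x → weighted M (λ y → invSq (x ℕ.+ y)))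
4*harmonic≤weighted² M = begin
  fromℕ 4 * harmonic M
    ≡⟨ ∑-ℓ₁-spheres M ⟨
  ∑[ N < suc M ] ∑[ x < suc N ] F x (N ∸ x)
    ≡⟨ ∑-triangle (suc M) F ⟨
  ∑[ x < suc M ] ∑[ y < suc M ∸ x ] F x y
    ≤⟨ ∑-mono-≤ (suc M) (λ x _ → ∑-mono-≤-length (F-nonNeg x) (ℕ.m∸n≤m (suc M) x)) ⟩
  ∑[ x < suc M ] ∑[ y < suc M ] F x y
    ≡⟨ ∑-cong (suc M) (λ x _ → *-distribˡ-∑ (suc M) (weight x) (λ y → weight y * invSq (x ℕ.+ y))) ⟨
  weighted M (λ x → weighted M (λ y → invSq (x ℕ.+ y)))
    ∎
  where
  open ≤-Reasoning
  F : ℕ → ℕ → ℚ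
  F x y = weight x * (weight y * invSq (x ℕ.+ y))
  F-nonNeg : ∀ x y → 0ℚ ≤ℚ F x y
  F-nonNeg x y = *-nonNeg (weight-nonNeg x) (*-nonNeg (weight-nonNeg y) (invSq-nonNeg (x ℕ.+ y)))

harmonic≤Zinv/4 : ∀ {n} M (u : Vertex n) → M ℕ.+ M ℕ.< n → harmonic M ≤ℚ Zinv n u * (+ 1 / 4)
harmonic≤Zinv/4 {n} M (a , b) 2M<n = begin
  harmonic M                              ≡⟨ lemma (harmonic M) ⟩
  fromℕ 4 * harmonic M * (+ 1 / 4)        ≤⟨ *-monoʳ-≤-nonNeg (+ 1 / 4) {{normalize-nonNeg 1 4}}
                                               (≤-trans (4*harmonic≤weighted² M)
                                                        (weighted²≤Zinv M a b 2M<n)) ⟩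
  Zinv n (a , b) * (+ 1 / 4)              ∎
  where
  open ≤-Reasoning
  open +-*-Solver
  lemma : ∀ h → h ≡ fromℕ 4 * h * (+ 1 / 4)
  lemma = solve 1 (λ h → h := con (fromℕ 4) :* h :* con (+ 1 / 4)) refl

⌊n/2⌋+⌊n/2⌋≤n : ∀ n → ⌊ n /2⌋ ℕ.+ ⌊ n /2⌋ ℕ.≤ n
⌊n/2⌋+⌊n/2⌋≤n n = ℕ.≤-trans (ℕ.+-monoʳ-≤ ⌊ n /2⌋ (ℕ.⌊n/2⌋≤⌈n/2⌉ n)) (ℕ.≤-reflexive (ℕ.⌊n/2⌋+⌈n/2⌉≡n n))

n≤1+⌊n/2⌋+⌊n/2⌋ : ∀ n → n ℕ.≤ suc (⌊ n /2⌋ ℕ.+ ⌊ n /2⌋)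
n≤1+⌊n/2⌋+⌊n/2⌋ n = begin
  n                           ≡⟨ ℕ.⌊n/2⌋+⌈n/2⌉≡n n ⟨
  ⌊ n /2⌋ ℕ.+ ⌈ n /2⌉         ≤⟨ ℕ.+-monoʳ-≤ ⌊ n /2⌋ (ℕ.⌊n/2⌋-mono (ℕ.n≤1+n (suc n))) ⟩
  ⌊ n /2⌋ ℕ.+ suc ⌊ n /2⌋     ≡⟨ ℕ.+-suc ⌊ n /2⌋ ⌊ n /2⌋ ⟩
  suc (⌊ n /2⌋ ℕ.+ ⌊ n /2⌋)   ∎
  where open ℕ.≤-Reasoning

harmonic≤⇒LnLess-half : ∀ {n r} M → n ℕ.≤ 2 ℕ.+ (M ℕ.+ M) →
                        0ℚ <ℚ harmonic M → harmonic M ≤ℚ r → LnLess (+ n / 2) r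
harmonic≤⇒LnLess-half {n} {r} M n≤2M+2 H>0 H≤r = 2 ℕ.+ M , (begin-strict
  + n / 2                            ≤⟨ /-≤-/ n 2 (suc M) 1 n*1≤[1+M]*2 ⟩
  fromℕ (suc M)                      ≤⟨ fromℕ-≤-expPartial-harmonic M ⟩
  expPartial (harmonic M) (suc M)    ≤⟨ expPartial-mono-≤ (harmonic-nonNeg M) H≤r (suc M) ⟩
  expPartial r (suc M)               <⟨ expPartial-<-suc (suc M) (<-≤-trans H>0 H≤r) ⟩
  expPartial r (2 ℕ.+ M)             ∎)
  where
  open ≤-Reasoning
  n*1≤[1+M]*2 : n ℕ.* 1 ℕ.≤ suc M ℕ.* 2
  n*1≤[1+M]*2 = subst₂ ℕ._≤_ (sym (ℕ.*-identityʳ n)) (lemma M) n≤2M+2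
    where
    lemma : ∀ M → 2 ℕ.+ (M ℕ.+ M) ≡ suc M ℕ.* 2
    lemma = solve-∀

theorem6 : (n : ℕ) → 3 ≤ n → (u : Vertex n) →
    LnLess ((+ n) / 2) (Zinv n u * ((+ 1) / 4))
theorem6 .(3 ℕ.+ m) (s≤s (s≤s (s≤s {n = m} z≤n))) u =
  harmonic≤⇒LnLess-half M (s≤s (n≤1+⌊n/2⌋+⌊n/2⌋ (2 ℕ.+ m))) (harmonic-pos ⌊ m /2⌋)
    (harmonic≤Zinv/4 M u (s≤s (⌊n/2⌋+⌊n/2⌋≤n (2 ℕ.+ m))))
  where
  -- M reduces to suc ⌊ m /2⌋, which is what harmonic-pos needs.
  M : ℕ
  M = ⌊ 2 ℕ.+ m /2⌋
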